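{- Let $S$ be a finite set of alternatives, $V=\{1,\dots,N\}$ a finite set of voters, and $f:\Pi_S^V\to\Pi_S$ a clerical-dictatorial social welfare function. Then $f$ satisfies Independence of Irrelevant Alternatives.
   Context: $\Pi_S$ denotes the set of complete transitive binary relations (weak preferences) on $S$; for $R\in\Pi_S$ we write $x\le_R y$ for $(x,y)\in R$, and $x<_R y$, $x=_R y$ have the obvious meanings. A configuration is ${\bf R}=(R_1,\dots,R_N)\in\Pi_S^V$. A social welfare function (SWF) is any map $f:\Pi_S^V\to\Pi_S$ (for any finite voter set $V$, possibly empty). Independence of Irrelevant Alternatives (IIA): whenever ${\bf P},{\bf Q}\in\Pi_S^V$ agree (for every voter) on the pair $\{x,y\}$, $f({\bf P})$ and $f({\bf Q})$ agree on $\{x,y\}$. $f$ is null if $x=_{f({\bf R})}y$ for all ${\bf R}$ and all $x,y$. $f$ is dictatorial with dictator $i$ if either for all $x,y,{\bf R}$: $x\le_{f({\bf R})}y\Rightarrow x\le_{R_i}y$, or for all $x,y,{\bf R}$: $x\le_{f({\bf R})}y\Rightarrow y\le_{R_i}x$. For ${\bf R}\in\Pi_S^V$, ${\bf R}_{ -i}\in\Pi_S^{V\setminus\{i\}}$ is its restriction to voters other than $i$. A dictatorial $f$ with dictator $i$ defers to $g:\Pi_S^{V\setminus\{i\}}\to\Pi_S$ over $i$ if for all $x,y\in S$ and ${\bf R}$ with $x=_{R_i}y$: $x\le_{f({\bf R})}y\iff x\le_{g({\bf R}_{ -i})}y$. $f$ is clerical with cleric $C\in\Pi_S$ if for all $x,y,{\bf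 R}$: $x\le_{f({\bf R})}y\Rightarrow x\le_C y$. For $A\subseteq S$, the restriction $f|_A:\Pi_A^V\to\Pi_A$ is defined by: given ${\bf R}\in\Pi_A^V$ pick any ${\bf R}'\in\Pi_S^V$ agreeing with ${\bf R}$ on all pairs in $A$, and set $x\le_{f|_A({\bf R})}y$ iff $x\le_{f({\bf R}')}y$ for $x,y\in A$; $f|_A$ is well defined if this does not depend on the choice of ${\bf R}'$. Clerical-dictatorial (recursive definition): $f:\Pi_S^V\to\Pi_S$ is clerical-dictatorial if it is null, or $|S|\le 2$, or there is a cleric $C\in\Pi_S$ such that (1) $f$ is clerical with cleric $C$, and (2) for every equivalence class $A$ of $C$: (a) $f|_A$ is well defined and is null, dictatorial, or $|A|=2$; (b) if $f|_A$ is dictatorial (with dictator $j$) then it defers over $j$ to a clerical-dictatorial function $\Pi_A^{V\setminus\{j\}}\to\Pi_A$. -}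

module Defs where

open import Level using (0ℓ)
open import Data.Bool using (Bool; true; false; _∧_)
open import Data.Nat using (ℕ)
open import Data.Fin using (Fin)
open import Data.Product using (Σ; _×_; _,_; proj₁; proj₂; ∃)
open import Data.Sum using (_⊎_; inj₁; inj₂)
open import Relation.Binary.PropositionalEquality using (_≡_; _≢_; refl)
open import Function.Bundles using (_⇔_)

-- The relation is Bool-valued, so that "x ≤_R y" is the proposition
-- rel x y ≡ true (proof-irrelevant, decidable: relations as subsets).

record Pref (X : Set) : Set where
  field
    rel   : X → X → Bool
    total : ∀ x y → rel x y ≡ true ⊎ rel y x ≡ true
    trans : ∀ x y z → rel x y ≡ true → rel y z ≡ true → rel x z ≡ true
open Pref public

_≤[_]_ : {X : Set} → X → Pref X → X → Set
x ≤[ R ] y = rel R x y ≡ true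

_=[_]_ : {X : Set} → X → Pref X → X → Set
x =[ R ] y = (x ≤[ R ] y) × (y ≤[ R ] x)

AgreeOn : {X : Set} → Pref X → Pref X → X → X → Set
AgreeOn P Q x y = ((x ≤[ P ] y) ⇔ (x ≤[ Q ] y)) × ((y ≤[ P ] x) ⇔ (y ≤[ Q ] x))

SameRel : {X : Set} → Pref X → Pref X → Set
SameRel P Q = ∀ x y → (x ≤[ P ] y) ⇔ (x ≤[ Q ] y)

-- Since a preference is a relation (a set of pairs), a map
-- on preferences must respect equality of relations; this is recorded
-- explicitly (Agda has no function extensionality).

record SWF (X W : Set) : Set where
  field
    fun  : (W → Pref X) → Pref X
    resp : ∀ P Q → (∀ i → SameRel (P i) (Q i)) → SameRel (fun P) (fun Q)
open SWF public

IIA : {X W : Set} → ((W → Pref X) → Pref X) → Set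
IIA {X} {W} f = ∀ (P Q : W → Pref X) (x y : X) →
  (∀ i → AgreeOn (P i) (Q i) x y) → AgreeOn (f P) (f Q) x y

Null : {X W : Set} → ((W → Pref X) → Pref X) → Set
Null {X} {W} f = ∀ (R : W → Pref X) (x y : X) → x =[ f R ] y

DictatorialWith : {X W : Set} → ((W → Pref X) → Pref X) → W → Set
DictatorialWith {X} {W} f i =
    (∀ (x y : X) (R : W → Pref X) → x ≤[ f R ] y → x ≤[ R i ] y)
  ⊎ (∀ (x y : X) (R : W → Pref X) → x ≤[ f R ] y → y ≤[ R i ] x)

Dictatorial : {X W : Set} → ((W → Pref X) → Pref X) → Set
Dictatorial {X} {W} f = Σ W (λ i → DictatorialWith f i)

Minus : (W : Set) → W → Set
Minus W j = Σ W (λ i → i ≢ j)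

drop : {X W : Set} (j : W) → (W → Pref X) → (Minus W j → Pref X)
drop j R (i , _) = R i

DefersOver : {X W : Set} → ((W → Pref X) → Pref X) → (i : W) →
             ((Minus W i → Pref X) → Pref X) → Set
DefersOver {X} {W} f i g = ∀ (x y : X) (R : W → Pref X) → x =[ R i ] y →
  (x ≤[ f R ] y) ⇔ (x ≤[ g (drop i R) ] y)

Clerical : {X W : Set} → ((W → Pref X) → Pref X) → Pref X → Set
Clerical {X} {W} f C = ∀ (x y : X) (R : W → Pref X) → x ≤[ f R ] y → x ≤[ C ] y

Sub : {X : Set} → (X → Bool) → Set
Sub {X} m = Σ X (λ x → m x ≡ true)

restrictPref : {X : Set} (m : X → Bool) → Pref X → Pref (Sub m)
restrictPref m R = record
  { rel   = λ a b → rel R (proj₁ a) (proj₁ b)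
  ; total = λ a b → total R (proj₁ a) (proj₁ b)
  ; trans = λ a b c → trans R (proj₁ a) (proj₁ b) (proj₁ c)
  }

module Extend {X : Set} (m : X → Bool) (R : Pref (Sub m)) where
  -- elements of the subset on top ordered by R, all others tied below
  relE' : (x y : X) (bx by : Bool) → m x ≡ bx → m y ≡ by → Bool
  relE' x y true  true  px py = rel R (x , px) (y , py)
  relE' x y false true  px py = true
  relE' x y true  false px py = false
  relE' x y false false px py = true

  relE : X → X → Bool
  relE x y = relE' x y (m x) (m y) refl refl

  totE' : ∀ x y bx by (px : m x ≡ bx) (py : m y ≡ by) →
          relE' x y bx by px py ≡ true ⊎ relE' y x by bx py px ≡ true
  totE' x y true  true  px py = total R (x , px) (y , py)
  totE' x y false true  px py = inj₁ refl
  totE' x y true  false px py = inj₂ refl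
  totE' x y false false px py = inj₁ refl

  trE' : ∀ x y z bx by bz (px : m x ≡ bx) (py : m y ≡ by) (pz : m z ≡ bz) →
         relE' x y bx by px py ≡ true → relE' y z by bz py pz ≡ true →
         relE' x z bx bz px pz ≡ true
  trE' x y z true  true  true  px py pz p q = trans R (x , px) (y , py) (z , pz) p q
  trE' x y z true  true  false px py pz p ()
  trE' x y z true  false bz    px py pz () q
  trE' x y z false by    true  px py pz p q = refl
  trE' x y z false by    false px py pz p q = refl

  extendPref : Pref X
  extendPref = record
    { rel   = relE
    ; total = λ x y → totE' x y (m x) (m y) refl refl
    ; trans = λ x y z → trE' x y z (m x) (m y) (m z) refl refl refl
    }

extendPref : {X : Set} (m : X → Bool) → Pref (Sub m) → Pref X
extendPref m R = Extend.extendPref m R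

-- the restriction f|_A (computed from one particular extension R')
restrictSWF : {X W : Set} (m : X → Bool) → ((W → Pref X) → Pref X) →
              (W → Pref (Sub m)) → Pref (Sub m)
restrictSWF m f R = restrictPref m (f (λ i → extendPref m (R i)))

-- f|_A is well defined: the result does not depend on the choice of R'
WellDefinedOn : {X W : Set} (m : X → Bool) → ((W → Pref X) → Pref X) → Set
WellDefinedOn {X} {W} m f = ∀ (R : W → Pref (Sub m)) (R' : W → Pref X) →
  (∀ i → SameRel (restrictPref m (R' i)) (R i)) →
  SameRel (restrictPref m (f R')) (restrictSWF m f R)

classOf : {X : Set} → Pref X → X → X → Bool
classOf C a x = rel C x a ∧ rel C a x

AtMostTwo : Set → Set
AtMostTwo Y = ∀ (x y z : Y) → x ≡ y ⊎ y ≡ z ⊎ x ≡ z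

ExactlyTwo : Set → Set
ExactlyTwo Y = Σ Y (λ a → Σ Y (λ b → a ≢ b × (∀ x → x ≡ a ⊎ x ≡ b)))

data ClericalDictatorial : (X W : Set) → SWF X W → Set₁ where
  cd-null  : ∀ {X W} (f : SWF X W) → Null (fun f) → ClericalDictatorial X W f
  cd-small : ∀ {X W} (f : SWF X W) → AtMostTwo X → ClericalDictatorial X W f
  cd-cleric : ∀ {X W} (f : SWF X W) (C : Pref X) →
    Clerical (fun f) C →
    (∀ (a : X) →
        ( WellDefinedOn (classOf C a) (fun f)
        × ( Null (restrictSWF (classOf C a) (fun f))
          ⊎ Dictatorial (restrictSWF (classOf C a) (fun f))
          ⊎ ExactlyTwo (Sub (classOf C a)) ) )
      × (∀ (j : W) → DictatorialWith (restrictSWF (classOf C a) (fun f)) j →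
           Σ (SWF (Sub (classOf C a)) (Minus W j)) (λ g →
               ClericalDictatorial (Sub (classOf C a)) (Minus W j) g
             × DefersOver (restrictSWF (classOf C a) (fun f)) j (fun g)))) →
    ClericalDictatorial X W f

module Submission where

-- A pair lying in two
-- different classes of the cleric C is ordered strictly by C, and f
-- copies that strict order whatever the profile. A pair inside one class
-- A is decided by the well-defined restriction f|_A, which is IIA
-- because it is null; or because A has two elements, so agreement on the
-- pair is agreement of the whole profile; or because it has a dictator j:
-- a strict preference of j decides the pair, and a tie of j hands the
-- pair to a smaller clerical-dictatorial function, IIA by induction.

open import Defs
open import Level using (0ℓ)
open import Data.Nat using (ℕ)
open import Data.Fin using (Fin)
open import Data.Fin.Properties using () renaming (_≟_ to _≟ᶠ_)
open import Data.Bool using (Bool; true; false)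
open import Data.Bool.Properties using () renaming (_≟_ to _≟ᵇ_)
open import Data.Product using (_,_; proj₁; proj₂)
open import Data.Product.Properties using (≡-dec)
open import Data.Sum using (_⊎_; inj₁; inj₂)
open import Data.Empty using (⊥-elim)
open import Function.Base using (_∘_)
open import Function.Bundles using (_⇔_; mk⇔; module Equivalence)
open import Function.Properties.Equivalence using (⇔-isEquivalence)
open import Relation.Nullary using (¬_; Dec; yes; no)
open import Relation.Binary.Definitions using (DecidableEquality)
open import Relation.Binary.Structures using (IsEquivalence)
open import Relation.Binary.PropositionalEquality using (_≡_; refl; sym)
open import Axiom.UniquenessOfIdentityProofs using (module Decidable⇒UIP)

open IsEquivalence (⇔-isEquivalence {ℓ = 0ℓ})
  using () renaming (refl to ⇔-refl; sym to ⇔-sym; trans to ⇔-trans)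

private
  variable
    X W : Set
    x y : X

≡-decSub : DecidableEquality X → (m : X → Bool) → DecidableEquality (Sub m)
≡-decSub _≟_ m = ≡-dec _≟_ (λ p q → yes (Decidable⇒UIP.≡-irrelevant _≟ᵇ_ p q))

_≤?[_]_ : (x : X) (R : Pref X) (y : X) → Dec (x ≤[ R ] y)
x ≤?[ R ] y = rel R x y ≟ᵇ true

≤-refl : (R : Pref X) (x : X) → x ≤[ R ] x
≤-refl R x with total R x x
... | inj₁ x≤x = x≤x
... | inj₂ x≤x = x≤x

≰⇒≥ : (R : Pref X) → ¬ (x ≤[ R ] y) → y ≤[ R ] x
≰⇒≥ {x = x} {y = y} R x≰y with total R x y
... | inj₁ x≤y = ⊥-elim (x≰y x≤y)
... | inj₂ y≤x = y≤x

classOf-member : (C : Pref X) {a : X} → y ≤[ C ] a → a ≤[ C ] y → classOf C a y ≡ true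
classOf-member C y≤a a≤y rewrite y≤a | a≤y = refl

module _ (A B : Pref X) where

  agreeOn-refl : AgreeOn A B x x
  agreeOn-refl {x = x} = both , both
    where both = mk⇔ (λ _ → ≤-refl B x) (λ _ → ≤-refl A x)

  agreeOn-swap : AgreeOn A B y x → AgreeOn A B x y
  agreeOn-swap (yx , xy) = xy , yx

  agreeOn-sym : AgreeOn A B x y → AgreeOn B A x y
  agreeOn-sym (xy , yx) = ⇔-sym xy , ⇔-sym yx

  agreeOn-trans : (C : Pref X) → AgreeOn A B x y → AgreeOn B C x y → AgreeOn A C x y
  agreeOn-trans C (xy , yx) (xy′ , yx′) = ⇔-trans xy xy′ , ⇔-trans yx yx′

  agreeOn-≰ : AgreeOn A B x y → ¬ (y ≤[ A ] x) → ¬ (y ≤[ B ] x)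
  agreeOn-≰ (_ , yx) y≰x = y≰x ∘ Equivalence.from yx

  agreeOn-tie : AgreeOn A B x y → x =[ A ] y → x =[ B ] y
  agreeOn-tie (xy , yx) (x≤y , y≤x) = Equivalence.to xy x≤y , Equivalence.to yx y≤x

  agreeOn-strict : ¬ (y ≤[ A ] x) → ¬ (y ≤[ B ] x) → AgreeOn A B x y
  agreeOn-strict A-y≰x B-y≰x =
    mk⇔ (λ _ → ≰⇒≥ B B-y≰x) (λ _ → ≰⇒≥ A A-y≰x) ,
    mk⇔ (⊥-elim ∘ A-y≰x) (⊥-elim ∘ B-y≰x)

  sameRel⇒agreeOn : SameRel A B → (x y : X) → AgreeOn A B x y
  sameRel⇒agreeOn same x y = same x y , same y x

  agreeOn-pair⇒sameRel : AgreeOn A B x y → (∀ z → z ≡ x ⊎ z ≡ y) → SameRel A B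
  agreeOn-pair⇒sameRel agree pair u v with pair u | pair v
  ... | inj₁ refl | inj₁ refl = proj₁ (agreeOn-refl {x = u})
  ... | inj₂ refl | inj₂ refl = proj₁ (agreeOn-refl {x = u})
  ... | inj₁ refl | inj₂ refl = proj₁ agree
  ... | inj₂ refl | inj₁ refl = proj₂ agree

null⇒IIA : (F : (W → Pref X) → Pref X) → Null F → IIA F
null⇒IIA F null P Q x y _ =
  mk⇔ (λ _ → proj₁ (null Q x y)) (λ _ → proj₁ (null P x y)) ,
  mk⇔ (λ _ → proj₂ (null Q x y)) (λ _ → proj₂ (null P x y))

exactlyTwo⇒atMostTwo : ExactlyTwo X → AtMostTwo X
exactlyTwo⇒atMostTwo (a , b , _ , ab) x y z with ab x | ab y | ab z
... | inj₁ refl | inj₁ refl | _         = inj₁ refl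
... | inj₂ refl | inj₂ refl | _         = inj₁ refl
... | _         | inj₁ refl | inj₁ refl = inj₂ (inj₁ refl)
... | _         | inj₂ refl | inj₂ refl = inj₂ (inj₁ refl)
... | inj₁ refl | _         | inj₁ refl = inj₂ (inj₂ refl)
... | inj₂ refl | _         | inj₂ refl = inj₂ (inj₂ refl)

atMostTwo⇒IIA : DecidableEquality X → AtMostTwo X → (f : SWF X W) → IIA (fun f)
atMostTwo⇒IIA _≟_ atMostTwo f P Q x y agree with x ≟ y
... | yes refl = agreeOn-refl (fun f P) (fun f Q)
... | no x≢y =
  sameRel⇒agreeOn (fun f P) (fun f Q)
    (resp f P Q (λ i → agreeOn-pair⇒sameRel (P i) (Q i) (agree i) pair)) x y
  where
  pair : ∀ z → z ≡ x ⊎ z ≡ y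
  pair z with atMostTwo x y z
  ... | inj₁ x≡y        = ⊥-elim (x≢y x≡y)
  ... | inj₂ (inj₁ y≡z) = inj₂ (sym y≡z)
  ... | inj₂ (inj₂ x≡z) = inj₁ (sym x≡z)

dictator-strict-agreeOn : {F : (W → Pref X) → Pref X} {j : W} {P Q : W → Pref X} →
  DictatorialWith F j → AgreeOn (P j) (Q j) x y → ¬ (y ≤[ P j ] x) →
  AgreeOn (F P) (F Q) x y
dictator-strict-agreeOn {x = x} {y = y} {F = F} {j = j} {P = P} {Q = Q} (inj₁ follows) agree y≰x =
  agreeOn-strict (F P) (F Q) (y≰x ∘ follows y x P) (Qj-y≰x ∘ follows y x Q)
  where Qj-y≰x = agreeOn-≰ (P j) (Q j) agree y≰x
dictator-strict-agreeOn {x = x} {y = y} {F = F} {j = j} {P = P} {Q = Q} (inj₂ reverses) agree y≰x =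
  agreeOn-swap (F P) (F Q)
    (agreeOn-strict (F P) (F Q) (y≰x ∘ reverses x y P) (Qj-y≰x ∘ reverses x y Q))
  where Qj-y≰x = agreeOn-≰ (P j) (Q j) agree y≰x

defersOver-agreeOn : {F : (W → Pref X) → Pref X} {i : W} {g : (Minus W i → Pref X) → Pref X} →
  DefersOver F i g → (R : W → Pref X) → x =[ R i ] y → AgreeOn (F R) (g (drop i R)) x y
defersOver-agreeOn {x = x} {y = y} defers R (x≤y , y≤x) =
  defers x y R (x≤y , y≤x) , defers y x R (y≤x , x≤y)

deferringDictator⇒IIA : {F : (W → Pref X) → Pref X} {j : W} {g : (Minus W j → Pref X) → Pref X} →
  DictatorialWith F j → IIA g → DefersOver F j g → IIA F
deferringDictator⇒IIA {F = F} {j = j} {g = g} dictator gIIA defers P Q x y agree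
  with y ≤?[ P j ] x | x ≤?[ P j ] y
... | no y≰x | _ = dictator-strict-agreeOn {F = F} dictator (agree j) y≰x
... | yes _  | no x≰y =
  agreeOn-swap (F P) (F Q)
    (dictator-strict-agreeOn {F = F} dictator (agreeOn-swap (P j) (Q j) (agree j)) x≰y)
... | yes y≤x | yes x≤y =
  agreeOn-trans (F P) (g P₋) (F Q) (defersOver-agreeOn {F = F} {g = g} defers P tieP)
    (agreeOn-trans (g P₋) (g Q₋) (F Q) (gIIA P₋ Q₋ x y (λ { (i , _) → agree i }))
      (agreeOn-sym (F Q) (g Q₋) (defersOver-agreeOn {F = F} {g = g} defers Q tieQ)))
  where
  P₋ = drop j P
  Q₋ = drop j Q
  tieP : x =[ P j ] y
  tieP = x≤y , y≤x
  tieQ : x =[ Q j ] y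
  tieQ = agreeOn-tie (P j) (Q j) (agree j) tieP

clerical-strict-agreeOn : {F : (W → Pref X) → Pref X} {C : Pref X} → Clerical F C →
  (P Q : W → Pref X) {x y : X} → ¬ (y ≤[ C ] x) → AgreeOn (F P) (F Q) x y
clerical-strict-agreeOn {F = F} {C = C} clerical P Q {x} {y} y≰x =
  agreeOn-strict (F P) (F Q) (y≰x ∘ clerical y x P) (y≰x ∘ clerical y x Q)

extendPref-resp : (m : X → Bool) (R₁ R₂ : Pref (Sub m)) → SameRel R₁ R₂ →
  SameRel (extendPref m R₁) (extendPref m R₂)
extendPref-resp m R₁ R₂ same x y = compare (m x) (m y) refl refl
  where
  compare : ∀ bx by (px : m x ≡ bx) (py : m y ≡ by) →
    (Extend.relE' m R₁ x y bx by px py ≡ true) ⇔ (Extend.relE' m R₂ x y bx by px py ≡ true)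
  compare true  true  px py = same (x , px) (y , py)
  compare true  false px py = ⇔-refl
  compare false true  px py = ⇔-refl
  compare false false px py = ⇔-refl

restrict : (m : X → Bool) → SWF X W → SWF (Sub m) W
restrict m f = record
  { fun  = restrictSWF m (fun f)
  ; resp = λ R₁ R₂ same a b →
      resp f (extendPref m ∘ R₁) (extendPref m ∘ R₂)
        (λ i → extendPref-resp m (R₁ i) (R₂ i) (same i)) (proj₁ a) (proj₁ b)
  }

restriction-agreeOn : {F : (W → Pref X) → Pref X} (m : X → Bool) →
  WellDefinedOn m F → IIA (restrictSWF m F) → {x y : X} → m x ≡ true → m y ≡ true →
  (P Q : W → Pref X) → (∀ i → AgreeOn (P i) (Q i) x y) → AgreeOn (F P) (F Q) x y
restriction-agreeOn {W = W} {X = X} {F = F} m wellDefined restrictionIIA {x} {y} mx my P Q agree =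
  agreeOn-trans (F|ₘ P) (F|ₘ′ P) {x = a} {y = b} (F|ₘ Q) (viaRestriction P)
    (agreeOn-trans (F|ₘ′ P) (F|ₘ′ Q) {x = a} {y = b} (F|ₘ Q)
      (restrictionIIA (restrictPref m ∘ P) (restrictPref m ∘ Q) a b agree)
      (agreeOn-sym (F|ₘ Q) (F|ₘ′ Q) {x = a} {y = b} (viaRestriction Q)))
  where
  a b : Sub m
  a = x , mx
  b = y , my
  F|ₘ F|ₘ′ : (W → Pref X) → Pref (Sub m)
  F|ₘ R  = restrictPref m (F R)
  F|ₘ′ R = restrictSWF m F (restrictPref m ∘ R)
  viaRestriction : (R : W → Pref X) → AgreeOn (F|ₘ R) (F|ₘ′ R) a b
  viaRestriction R =
    sameRel⇒agreeOn (F|ₘ R) (F|ₘ′ R) (wellDefined (restrictPref m ∘ R) R (λ _ _ _ → ⇔-refl)) a b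

clerical⇒IIA : {F : (W → Pref X) → Pref X} (C : Pref X) → Clerical F C →
  (∀ a → WellDefinedOn (classOf C a) F) → (∀ a → IIA (restrictSWF (classOf C a) F)) → IIA F
clerical⇒IIA {F = F} C clerical wellDefined classIIA P Q x y agree
  with y ≤?[ C ] x | x ≤?[ C ] y
... | no y≰x  | _      = clerical-strict-agreeOn {F = F} {C = C} clerical P Q y≰x
... | yes _   | no x≰y =
  agreeOn-swap (F P) (F Q) (clerical-strict-agreeOn {F = F} {C = C} clerical P Q x≰y)
... | yes y≤x | yes x≤y =
  restriction-agreeOn {F = F} (classOf C x) (wellDefined x) (classIIA x)
    (classOf-member C (≤-refl C x) (≤-refl C x)) (classOf-member C y≤x x≤y) P Q agree

clericalDictatorial⇒IIA : DecidableEquality X → (f : SWF X W) →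
  ClericalDictatorial X W f → IIA (fun f)
clericalDictatorial⇒IIA _≟_ f (cd-null _ null)      = null⇒IIA (fun f) null
clericalDictatorial⇒IIA _≟_ f (cd-small _ atMostTwo) = atMostTwo⇒IIA _≟_ atMostTwo f
clericalDictatorial⇒IIA {X = X} _≟_ f (cd-cleric _ C clerical classes) =
  clerical⇒IIA {F = fun f} C clerical (proj₁ ∘ proj₁ ∘ classes) classIIA
  where
  classIIA : (a : X) → IIA (restrictSWF (classOf C a) (fun f))
  classIIA a with classes a
  ... | (_ , inj₁ null) , _ = null⇒IIA (restrictSWF (classOf C a) (fun f)) null
  ... | (_ , inj₂ (inj₂ exactlyTwo)) , _ =
    atMostTwo⇒IIA (≡-decSub _≟_ (classOf C a)) (exactlyTwo⇒atMostTwo exactlyTwo)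
      (restrict (classOf C a) f)
  ... | (_ , inj₂ (inj₁ (j , dictator))) , defers with defers j dictator
  ...   | g , gCD , deferral =
    deferringDictator⇒IIA {F = restrictSWF (classOf C a) (fun f)} {g = fun g} dictator
      (clericalDictatorial⇒IIA (≡-decSub _≟_ (classOf C a)) g gCD) deferral

theorem8 : (n N : ℕ) (f : SWF (Fin n) (Fin N)) →
    ClericalDictatorial (Fin n) (Fin N) f → IIA (fun f)
theorem8 n N = clericalDictatorial⇒IIA _≟ᶠ_
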